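{- Let $\mathbf{D}$ be a dagger kernel category in which every zero-epi is an epimorphism. Then every dagger mono in $\mathbf{D}$ is a kernel.
   Context: A dagger category is a category with a contravariant functor $\dagger$ that is the identity on objects with $f^{\dagger\dagger}=f$; $f$ is a dagger mono if $f^\dagger\circ f=\mathrm{id}$. A dagger kernel category is a dagger category with a zero object $0$ in which every morphism $f$ has a kernel (universal $k$ with $f\circ k=0$) that can be chosen to be a dagger mono. A morphism $e$ is a zero-epi if $h\circ e=0$ implies $h=0$ for every morphism $h$. -}

module Defs where

open import Level using (Level; _⊔_; suc)
open import Data.Product using (Σ; Σ-syntax; _×_; _,_)
open import Relation.Binary using (IsEquivalence)

record Category (o ℓ e : Level) : Set (suc (o ⊔ ℓ ⊔ e)) where
  infixr 9 _∘_
  infix  4 _≈_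
  field
    Obj   : Set o
    Hom   : Obj → Obj → Set ℓ
    _≈_   : ∀ {A B} → Hom A B → Hom A B → Set e
    ≈-equiv : ∀ {A B} → IsEquivalence (_≈_ {A} {B})
    id    : ∀ {A} → Hom A A
    _∘_   : ∀ {A B C} → Hom B C → Hom A B → Hom A C
    assoc : ∀ {A B C D} {f : Hom A B} {g : Hom B C} {h : Hom C D} →
            (h ∘ g) ∘ f ≈ h ∘ (g ∘ f)
    identityˡ : ∀ {A B} {f : Hom A B} → id ∘ f ≈ f
    identityʳ : ∀ {A B} {f : Hom A B} → f ∘ id ≈ f
    ∘-resp-≈  : ∀ {A B C} {f h : Hom B C} {g i : Hom A B} →
                f ≈ h → g ≈ i → f ∘ g ≈ h ∘ i

record DaggerCategory (o ℓ e : Level) : Set (suc (o ⊔ ℓ ⊔ e)) where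
  field
    cat : Category o ℓ e
  open Category cat
  field
    _† : ∀ {A B} → Hom A B → Hom B A
    †-resp-≈ : ∀ {A B} {f g : Hom A B} → f ≈ g → f † ≈ g †
    †-identity : ∀ {A} → (id {A}) † ≈ id
    †-homomorphism : ∀ {A B C} {f : Hom A B} {g : Hom B C} →
                     (g ∘ f) † ≈ f † ∘ g †
    †-involutive : ∀ {A B} {f : Hom A B} → (f †) † ≈ f
  open Category cat public

module _ {o ℓ e} (D : DaggerCategory o ℓ e) where
  open DaggerCategory D

  IsDaggerMono : ∀ {A B} → Hom A B → Set e
  IsDaggerMono f = f † ∘ f ≈ id

  record IsZeroObject (Z : Obj) : Set (o ⊔ ℓ ⊔ e) where
    field
      ¡      : ∀ {A} → Hom Z A
      ¡-unique : ∀ {A} (f : Hom Z A) → ¡ ≈ f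
      !      : ∀ {A} → Hom A Z
      !-unique : ∀ {A} (f : Hom A Z) → ! ≈ f

  module _ {Z : Obj} (isZ : IsZeroObject Z) where
    open IsZeroObject isZ

    zeroHom : ∀ {A B} → Hom A B
    zeroHom = ¡ ∘ !

    record IsKernel {K A B : Obj} (k : Hom K A) (f : Hom A B) : Set (o ⊔ ℓ ⊔ e) where
      field
        commute   : f ∘ k ≈ zeroHom
        universal : ∀ {X} (m : Hom X A) → f ∘ m ≈ zeroHom →
                    Σ[ u ∈ Hom X K ] (k ∘ u ≈ m × (∀ (v : Hom X K) → k ∘ v ≈ m → v ≈ u))

    IsAKernel : ∀ {K A} → Hom K A → Set (o ⊔ ℓ ⊔ e)
    IsAKernel {K} {A} k = Σ[ B ∈ Obj ] Σ[ f ∈ Hom A B ] IsKernel k f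

    IsZeroEpi : ∀ {A B} → Hom A B → Set (o ⊔ ℓ ⊔ e)
    IsZeroEpi {A} {B} e = ∀ {C} (h : Hom B C) → h ∘ e ≈ zeroHom → h ≈ zeroHom

  IsEpi : ∀ {A B} → Hom A B → Set (o ⊔ ℓ ⊔ e)
  IsEpi {A} {B} f = ∀ {C} (g h : Hom B C) → g ∘ f ≈ h ∘ f → g ≈ h

record DaggerKernelCategory (o ℓ e : Level) : Set (suc (o ⊔ ℓ ⊔ e)) where
  field
    dagger : DaggerCategory o ℓ e
  open DaggerCategory dagger
  field
    𝟘 : Obj
    𝟘-isZero : IsZeroObject dagger 𝟘
    kernel : ∀ {A B} (f : Hom A B) →
             Σ[ K ∈ Obj ] Σ[ k ∈ Hom K A ]
               (IsKernel dagger 𝟘-isZero k f × IsDaggerMono dagger k)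
  open DaggerCategory dagger public

module Submission where

-- Lemma: in a dagger kernel category in which every zero-epi is epi, every
-- dagger mono m : A → B is a kernel, namely of k†, where k = ker(m†).
--
-- Let l = ker(k†), a dagger mono.  Since k† ∘ m = 0, m factors as m = l ∘ a,
-- and a is again a dagger mono.  The crux is that a is a zero-epi: if
-- j = ker(a†), then l ∘ j is killed by m† (so it factors through k) and is
-- killed by k† (since k† ∘ l = 0); a morphism in the range of the dagger mono
-- k killed by k† is zero, so l ∘ j = 0 and hence j = 0, which forces a to be
-- zero-epi.  By hypothesis a is then epi, and an epic dagger mono is unitary.
-- Kernels are stable under precomposition with isomorphisms, so m = l ∘ a is
-- a kernel of k†.

open import Level using (Level)
open import Data.Product using (Σ-syntax; _×_; _,_)
open import Relation.Binary using (Setoid)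
import Relation.Binary.Reasoning.Setoid as SetoidReasoning
open import Defs

module DaggerZeroFacts {o ℓ e : Level} (D : DaggerCategory o ℓ e)
                       {Z : DaggerCategory.Obj D} (isZ : IsZeroObject D Z) where
  open DaggerCategory D
  open IsZeroObject isZ

  homSetoid : Obj → Obj → Setoid ℓ e
  homSetoid A B = record { Carrier = Hom A B ; _≈_ = _≈_ ; isEquivalence = ≈-equiv }

  open module HomSetoid {A B : Obj} = Setoid (homSetoid A B)
    using () renaming (refl to ≈-refl; sym to ≈-sym; trans to ≈-trans) public
  open module HomReasoning {A B : Obj} = SetoidReasoning (homSetoid A B) public

  ∘-resp-≈ˡ : ∀ {A B C} {f h : Hom B C} {g : Hom A B} → f ≈ h → f ∘ g ≈ h ∘ g
  ∘-resp-≈ˡ p = ∘-resp-≈ p ≈-refl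

  ∘-resp-≈ʳ : ∀ {A B C} {f : Hom B C} {g i : Hom A B} → g ≈ i → f ∘ g ≈ f ∘ i
  ∘-resp-≈ʳ p = ∘-resp-≈ ≈-refl p

  0ₕ : ∀ {A B} → Hom A B
  0ₕ = zeroHom D isZ

  zero-∘ : ∀ {A B C} (f : Hom A B) → 0ₕ {B} {C} ∘ f ≈ 0ₕ
  zero-∘ f = ≈-trans assoc (∘-resp-≈ʳ (≈-sym (!-unique _)))

  ∘-zero : ∀ {A B C} (f : Hom B C) → f ∘ 0ₕ {A} {B} ≈ 0ₕ
  ∘-zero f = ≈-trans (≈-sym assoc) (∘-resp-≈ˡ (≈-sym (¡-unique _)))

  zero-† : ∀ {A B} → 0ₕ {A} {B} † ≈ 0ₕ
  zero-† = ≈-trans †-homomorphism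
             (∘-resp-≈ (≈-sym (¡-unique _)) (≈-sym (!-unique _)))

  †-reflects-zero : ∀ {A B} {f : Hom A B} → f † ≈ 0ₕ → f ≈ 0ₕ
  †-reflects-zero {f = f} p = begin
    f       ≈⟨ ≈-sym †-involutive ⟩
    f † †   ≈⟨ †-resp-≈ p ⟩
    0ₕ †    ≈⟨ zero-† ⟩
    0ₕ      ∎

  †-cancel : ∀ {A B X} {k : Hom A B} → IsDaggerMono D k →
             (x : Hom X A) → k † ∘ (k ∘ x) ≈ x
  †-cancel k-dmono x = ≈-trans (≈-sym assoc) (≈-trans (∘-resp-≈ˡ k-dmono) identityˡ)

  dmono-reflects-zero : ∀ {A B X} {k : Hom A B} {x : Hom X A} →
                        IsDaggerMono D k → k ∘ x ≈ 0ₕ → x ≈ 0ₕ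
  dmono-reflects-zero {k = k} {x} k-dmono p = begin
    x              ≈⟨ ≈-sym (†-cancel k-dmono x) ⟩
    k † ∘ (k ∘ x)  ≈⟨ ∘-resp-≈ʳ p ⟩
    k † ∘ 0ₕ       ≈⟨ ∘-zero (k †) ⟩
    0ₕ             ∎

  range-killed-is-zero : ∀ {A B X} {k : Hom A B} {x : Hom X B} {c : Hom X A} →
                         IsDaggerMono D k → k ∘ c ≈ x → k † ∘ x ≈ 0ₕ → x ≈ 0ₕ
  range-killed-is-zero {k = k} {x} {c} k-dmono kc≈x k†x≈0 = begin
    x        ≈⟨ ≈-sym kc≈x ⟩
    k ∘ c    ≈⟨ ∘-resp-≈ʳ c≈0 ⟩
    k ∘ 0ₕ   ≈⟨ ∘-zero k ⟩
    0ₕ       ∎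
    where
    c≈0 : c ≈ 0ₕ
    c≈0 = begin
      c              ≈⟨ ≈-sym (†-cancel k-dmono c) ⟩
      k † ∘ (k ∘ c)  ≈⟨ ∘-resp-≈ʳ kc≈x ⟩
      k † ∘ x        ≈⟨ k†x≈0 ⟩
      0ₕ             ∎

  dmono-right-factor : ∀ {A B C} {l : Hom B C} {a : Hom A B} →
                       IsDaggerMono D l → IsDaggerMono D (l ∘ a) → IsDaggerMono D a
  dmono-right-factor {l = l} {a} l-dmono la-dmono = begin
    a † ∘ a                  ≈⟨ ∘-resp-≈ʳ (≈-sym (†-cancel l-dmono a)) ⟩
    a † ∘ (l † ∘ (l ∘ a))    ≈⟨ ≈-sym assoc ⟩
    (a † ∘ l †) ∘ (l ∘ a)    ≈⟨ ∘-resp-≈ˡ (≈-sym †-homomorphism) ⟩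
    (l ∘ a) † ∘ (l ∘ a)      ≈⟨ la-dmono ⟩
    id                       ∎

  epic-dmono-unitary : ∀ {A B} {a : Hom A B} →
                       IsDaggerMono D a → IsEpi D a → a ∘ a † ≈ id
  epic-dmono-unitary {a = a} a-dmono a-epi = a-epi (a ∘ a †) id (begin
    (a ∘ a †) ∘ a   ≈⟨ assoc ⟩
    a ∘ (a † ∘ a)   ≈⟨ ∘-resp-≈ʳ a-dmono ⟩
    a ∘ id          ≈⟨ identityʳ ⟩
    a               ≈⟨ ≈-sym identityˡ ⟩
    id ∘ a          ∎)

  module _ {K A B : Obj} {k : Hom K A} {f : Hom A B} (k-ker : IsKernel D isZ k f) where
    open IsKernel k-ker

    factor : ∀ {X} {x : Hom X A} → f ∘ x ≈ 0ₕ → Σ[ u ∈ Hom X K ] k ∘ u ≈ x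
    factor {x = x} fx≈0 with universal x fx≈0
    ... | u , ku≈x , _ = u , ku≈x

    kernel-monic : ∀ {X} {x y : Hom X K} → k ∘ x ≈ k ∘ y → x ≈ y
    kernel-monic {x = x} {y} kx≈ky with universal (k ∘ y) fky≈0
      where
      fky≈0 : f ∘ (k ∘ y) ≈ 0ₕ
      fky≈0 = ≈-trans (≈-sym assoc) (≈-trans (∘-resp-≈ˡ commute) (zero-∘ y))
    ... | u , _ , unique = ≈-trans (unique x kx≈ky) (≈-sym (unique y ≈-refl))

    kernel-∘-iso : ∀ {A'} {a : Hom A' K} {a⁻¹ : Hom K A'} {m : Hom A' A} →
                   a⁻¹ ∘ a ≈ id → a ∘ a⁻¹ ≈ id → k ∘ a ≈ m → IsKernel D isZ m f
    kernel-∘-iso {A'} {a} {a⁻¹} {m} left-inv right-inv ka≈m = record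
      { commute = begin
          f ∘ m         ≈⟨ ∘-resp-≈ʳ (≈-sym ka≈m) ⟩
          f ∘ (k ∘ a)   ≈⟨ ≈-sym assoc ⟩
          (f ∘ k) ∘ a   ≈⟨ ∘-resp-≈ˡ commute ⟩
          0ₕ ∘ a        ≈⟨ zero-∘ a ⟩
          0ₕ            ∎
      ; universal = λ x fx≈0 → mediate x (factor fx≈0)
      }
      where
      mediate : ∀ {X} (x : Hom X A) → Σ[ u ∈ Hom X K ] k ∘ u ≈ x →
                Σ[ v ∈ Hom X A' ] (m ∘ v ≈ x × (∀ w → m ∘ w ≈ x → w ≈ v))
      mediate x (u , ku≈x) = a⁻¹ ∘ u , existence , uniqueness
        where
        existence : m ∘ (a⁻¹ ∘ u) ≈ x
        existence = begin
          m ∘ (a⁻¹ ∘ u)       ≈⟨ ∘-resp-≈ˡ (≈-sym ka≈m) ⟩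
          (k ∘ a) ∘ (a⁻¹ ∘ u) ≈⟨ assoc ⟩
          k ∘ (a ∘ (a⁻¹ ∘ u)) ≈⟨ ∘-resp-≈ʳ (≈-sym assoc) ⟩
          k ∘ ((a ∘ a⁻¹) ∘ u) ≈⟨ ∘-resp-≈ʳ (≈-trans (∘-resp-≈ˡ right-inv) identityˡ) ⟩
          k ∘ u               ≈⟨ ku≈x ⟩
          x                   ∎
        uniqueness : ∀ w → m ∘ w ≈ x → w ≈ a⁻¹ ∘ u
        uniqueness w mw≈x = begin
          w               ≈⟨ ≈-sym identityˡ ⟩
          id ∘ w          ≈⟨ ∘-resp-≈ˡ (≈-sym left-inv) ⟩
          (a⁻¹ ∘ a) ∘ w   ≈⟨ assoc ⟩
          a⁻¹ ∘ (a ∘ w)   ≈⟨ ∘-resp-≈ʳ (kernel-monic kaw≈ku) ⟩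
          a⁻¹ ∘ u         ∎
          where
          kaw≈ku : k ∘ (a ∘ w) ≈ k ∘ u
          kaw≈ku = ≈-trans (≈-sym assoc)
                     (≈-trans (∘-resp-≈ˡ ka≈m) (≈-trans mw≈x (≈-sym ku≈x)))

  kernel-of-†-kills : ∀ {K A B} {k : Hom K B} {f : Hom A B} →
                      IsKernel D isZ k (f †) → k † ∘ f ≈ 0ₕ
  kernel-of-†-kills {k = k} {f} k-ker = begin
    k † ∘ f       ≈⟨ ∘-resp-≈ʳ (≈-sym †-involutive) ⟩
    k † ∘ f † †   ≈⟨ ≈-sym †-homomorphism ⟩
    (f † ∘ k) †   ≈⟨ †-resp-≈ (IsKernel.commute k-ker) ⟩
    0ₕ †          ≈⟨ zero-† ⟩
    0ₕ            ∎

  zero-epi-if-†-kernel-zero : ∀ {J A B} {a : Hom A B} {j : Hom J B} →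
                              IsKernel D isZ j (a †) → j ≈ 0ₕ → IsZeroEpi D isZ a
  zero-epi-if-†-kernel-zero {a = a} {j} j-ker j≈0 h ha≈0 with factor j-ker a†h†≈0
    where
    a†h†≈0 : a † ∘ h † ≈ 0ₕ
    a†h†≈0 = ≈-trans (≈-sym †-homomorphism) (≈-trans (†-resp-≈ ha≈0) zero-†)
  ... | d , jd≈h† = †-reflects-zero (begin
    h †      ≈⟨ ≈-sym jd≈h† ⟩
    j ∘ d    ≈⟨ ∘-resp-≈ˡ j≈0 ⟩
    0ₕ ∘ d   ≈⟨ zero-∘ d ⟩
    0ₕ       ∎)

module DaggerKernelFacts {o ℓ e : Level} (D : DaggerKernelCategory o ℓ e) where
  open DaggerKernelCategory D
  open DaggerZeroFacts dagger 𝟘-isZero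

  corestriction-zero-epi :
    ∀ {A B K L} {m : Hom A B} {k : Hom K B} {l : Hom L B} {a : Hom A L} →
    IsKernel dagger 𝟘-isZero k (m †) → IsDaggerMono dagger k →
    IsKernel dagger 𝟘-isZero l (k †) → IsDaggerMono dagger l →
    l ∘ a ≈ m → IsZeroEpi dagger 𝟘-isZero a
  corestriction-zero-epi {m = m} {k} {l} {a} k-ker k-dmono l-ker l-dmono la≈m
    with kernel (a †)
  ... | _ , j , j-ker , _ = zero-epi-if-†-kernel-zero j-ker j≈0
    where
    m†lj≈0 : m † ∘ (l ∘ j) ≈ 0ₕ
    m†lj≈0 = begin
      m † ∘ (l ∘ j)           ≈⟨ ∘-resp-≈ˡ (†-resp-≈ (≈-sym la≈m)) ⟩
      (l ∘ a) † ∘ (l ∘ j)     ≈⟨ ∘-resp-≈ˡ †-homomorphism ⟩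
      (a † ∘ l †) ∘ (l ∘ j)   ≈⟨ assoc ⟩
      a † ∘ (l † ∘ (l ∘ j))   ≈⟨ ∘-resp-≈ʳ (†-cancel l-dmono j) ⟩
      a † ∘ j                 ≈⟨ IsKernel.commute j-ker ⟩
      0ₕ                      ∎

    k†lj≈0 : k † ∘ (l ∘ j) ≈ 0ₕ
    k†lj≈0 = begin
      k † ∘ (l ∘ j)   ≈⟨ ≈-sym assoc ⟩
      (k † ∘ l) ∘ j   ≈⟨ ∘-resp-≈ˡ (IsKernel.commute l-ker) ⟩
      0ₕ ∘ j          ≈⟨ zero-∘ j ⟩
      0ₕ              ∎

    j≈0 : j ≈ 0ₕ
    j≈0 with factor k-ker m†lj≈0
    ... | c , kc≈lj =
      dmono-reflects-zero l-dmono (range-killed-is-zero k-dmono kc≈lj k†lj≈0)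

lemma4p4 : ∀ {o ℓ e : Level} (D : DaggerKernelCategory o ℓ e) →
    let open DaggerKernelCategory D in
    (∀ {A B} (f : Hom A B) → IsZeroEpi dagger 𝟘-isZero f → IsEpi dagger f) →
    ∀ {A B} (m : Hom A B) → IsDaggerMono dagger m → IsAKernel dagger 𝟘-isZero m
lemma4p4 D zero-epi⇒epi m m-dmono = m-is-kernel
  where
  open DaggerKernelCategory D
  open DaggerZeroFacts dagger 𝟘-isZero
  open DaggerKernelFacts D

  m-is-kernel : IsAKernel dagger 𝟘-isZero m
  m-is-kernel with kernel (m †)
  ... | _ , k , k-ker , k-dmono with kernel (k †)
  ... | _ , l , l-ker , l-dmono with factor l-ker (kernel-of-†-kills k-ker)
  ... | a , la≈m = _ , _ , kernel-∘-iso l-ker a-dmono a-unitary la≈m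
    where
    a-dmono : IsDaggerMono dagger a
    a-dmono = dmono-right-factor l-dmono
                (≈-trans (∘-resp-≈ (†-resp-≈ la≈m) la≈m) m-dmono)

    a-zero-epi : IsZeroEpi dagger 𝟘-isZero a
    a-zero-epi = corestriction-zero-epi k-ker k-dmono l-ker l-dmono la≈m

    a-unitary : a ∘ a † ≈ id
    a-unitary = epic-dmono-unitary a-dmono (zero-epi⇒epi a a-zero-epi)
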